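{- There exists a family of 3-SAT formulas $(F_N)_N$ with $|\mathrm{vars}(F_N)|=\Theta(N)$ such that \[ \beta_2(S(F_N))\ge 2^{cN} \] for some constant $c>0$.
   Context: For a CNF formula $F$ on $n$ variables, the solution complex $S(F)$ is the cubical subcomplex of $\{0,1\}^n$ whose vertices are satisfying assignments and whose $k$-faces are axis-aligned $k$-dimensional subcubes all of whose $2^k$ vertices satisfy $F$. $\beta_2$ denotes the dimension of the second homology group over $\mathbb Z_2$. -}

module Defs where

open import Data.Nat using (ℕ; zero; suc; _+_)
open import Data.Bool using (Bool; true; false; _∧_; _∨_; _xor_; not; if_then_else_)
open import Data.Maybe using (Maybe; just; nothing)
open import Data.Fin using (Fin)
open import Data.Vec using (Vec; []; _∷_; lookup; zipWith)
open import Data.List using (List; []; _∷_; _++_; map; foldr; concatMap)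
open import Data.Product using (Σ; _×_; _,_; proj₁; proj₂)
open import Relation.Binary.PropositionalEquality using (_≡_)

-- CNF formulas on n variables; 3-CNF = every clause has 3 literals.
-- A literal (i , b) is satisfied by assignment v iff v_i = b.

Literal : ℕ → Set
Literal n = Fin n × Bool

Clause3 : ℕ → Set
Clause3 n = Vec (Literal n) 3

CNF3 : ℕ → Set
CNF3 n = List (Clause3 n)

Assignment : ℕ → Set
Assignment n = Vec Bool n

beq : Bool → Bool → Bool
beq true  b = b
beq false b = not b

litSat : ∀ {n} → Assignment n → Literal n → Bool
litSat v (i , b) = beq (lookup v i) b

anyV : ∀ {A : Set} {k} → (A → Bool) → Vec A k → Bool
anyV p []       = false
anyV p (x ∷ xs) = p x ∨ anyV p xs

clauseSat : ∀ {n} → Assignment n → Clause3 n → Bool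
clauseSat v c = anyV (litSat v) c

satisfies : ∀ {n} → Assignment n → CNF3 n → Bool
satisfies v []       = true
satisfies v (c ∷ cs) = clauseSat v c ∧ satisfies v cs

-- Axis-aligned subcubes of {0,1}^n: coordinate `nothing` is free,
-- `just b` is fixed to b.  Dimension = number of free coordinates.

Cube : ℕ → Set
Cube n = Vec (Maybe Bool) n

dim : ∀ {n} → Cube n → ℕ
dim []             = 0
dim (nothing ∷ σ)  = suc (dim σ)
dim (just _  ∷ σ)  = dim σ

vertexOf : ∀ {n} → Assignment n → Cube n → Bool
vertexOf []       []             = true
vertexOf (x ∷ v)  (nothing ∷ σ)  = vertexOf v σ
vertexOf (x ∷ v)  (just b ∷ σ)   = beq x b ∧ vertexOf v σ

-- σ is a face of the solution complex S(F): all its vertices satisfy F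
InS : ∀ {n} → CNF3 n → Cube n → Set
InS F σ = ∀ v → vertexOf v σ ≡ true → satisfies v F ≡ true

meq : Maybe Bool → Maybe Bool → Bool
meq nothing  nothing  = true
meq (just a) (just b) = beq a b
meq _        _        = false

cubeEq : ∀ {n} → Cube n → Cube n → Bool
cubeEq []       []       = true
cubeEq (x ∷ xs) (y ∷ ys) = meq x y ∧ cubeEq xs ys

isFacet : ∀ {n} → Cube n → Cube n → Bool
isFacet []             []             = false
isFacet (just _ ∷ τ)   (nothing ∷ σ)  = cubeEq τ σ
isFacet (t ∷ τ)        (s ∷ σ)        = meq t s ∧ isFacet τ σ

allCubes : (n : ℕ) → List (Cube n)
allCubes zero    = [] ∷ []
allCubes (suc n) =
  concatMap (λ σ → (nothing ∷ σ) ∷ (just false ∷ σ) ∷ (just true ∷ σ) ∷ [])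
            (allCubes n)

-- Cubical chains with Z_2 coefficients: a chain is a (finitely supported,
-- since Cube n is finite) Z_2-valued function on cubes.

Chain : ℕ → Set
Chain n = Cube n → Bool

xorSum : List Bool → Bool
xorSum = foldr _xor_ false

∂ : ∀ {n} → Chain n → Chain n
∂ {n} c τ = xorSum (map (λ σ → c σ ∧ isFacet τ σ) (allCubes n))

IsChain : ∀ {n} → CNF3 n → ℕ → Chain n → Set
IsChain F k c = ∀ σ → c σ ≡ true → (dim σ ≡ k) × InS F σ

IsCycle : ∀ {n} → CNF3 n → ℕ → Chain n → Set
IsCycle F k c = IsChain F k c × (∀ τ → ∂ c τ ≡ false)

IsBoundary : ∀ {n} → CNF3 n → ℕ → Chain n → Set
IsBoundary F k b = Σ (Chain _) λ d → IsChain F (suc k) d × (∀ τ → ∂ d τ ≡ b τ)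

lincomb : ∀ {n m} → Vec Bool m → Vec (Chain n) m → Chain n
lincomb []       []       σ = false
lincomb (s ∷ ss) (z ∷ zs) σ = (s ∧ z σ) xor lincomb ss zs σ

Nonzero : ∀ {m} → Vec Bool m → Set
Nonzero s = anyV (λ b → b) s ≡ true

-- dim_{Z_2} H_k(S(F)) ≥ m : there are m k-cycles whose classes in
-- H_k = Z_k / B_k are linearly independent over Z_2, i.e. no nontrivial
-- Z_2-combination of them is a boundary.
BettiAtLeast : ∀ {n} → CNF3 n → ℕ → ℕ → Set
BettiAtLeast {n} F k m =
  Σ (Vec (Chain n) m) λ zs →
    ((i : Fin m) → IsCycle F k (lookup zs i)) ×
    ((s : Vec Bool m) → Nonzero s → (IsBoundary F k (lincomb s zs) → Data.Empty.⊥))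
  where import Data.Empty

-- The solution complex of NAE(x, y, z) is the 3-cube with two antipodal vertices removed, i.e. a
-- hexagon of six edges. Hence S(NAE(x₁,x₂,x₃) ∧ NAE(x₄,x₅,x₆)) is a torus: the sum of its 36
-- squares is a 2-cycle, and since the complex has no 3-faces, no nonzero 2-cycle bounds.
-- Adding two fresh variables forced equal by the 3-clauses x ⇒ y and y ⇒ x turns S(F) into two
-- disjoint copies of S(F), which doubles β₂. After N doublings the formula has 6 + 2N variables
-- and β₂ ≥ 2^N.
module Submission where

open import Defs
open import Algebra.Bundles using (CommutativeRing)
open import Data.Bool using (Bool; true; false; _∧_; _xor_; not; if_then_else_)
open import Data.Bool.Properties
  using (∧-zeroʳ; ∧-identityʳ; ∧-distribˡ-xor; xor-identityʳ; xor-assoc; xor-∧-commutativeRing)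
  renaming (_≟_ to _≟ᵇ_)
open import Algebra.Properties.CommutativeSemigroup
  (CommutativeRing.+-commutativeSemigroup xor-∧-commutativeRing) using (interchange)
open import Data.Empty using (⊥-elim)
open import Data.Fin using (Fin; #_) renaming (zero to fzero; suc to fsuc)
open import Data.Fin.Subset.Properties using (anySubset?)
open import Data.List using (List; []; _∷_; map; concatMap) renaming (_++_ to _++ᴸ_)
open import Data.List.Properties using (map-cong)
open import Data.List.Membership.Propositional using (_∈_)
open import Data.List.Membership.Propositional.Properties using (∈-concatMap⁺)
open import Data.List.Relation.Unary.All as All using (all?)
open import Data.List.Relation.Unary.Any as Any using (here; there)
open import Data.Maybe using (Maybe; just; nothing)
open import Data.Nat using (ℕ; zero; suc; _+_; _*_; _^_; _≤_; z≤n; s≤s) renaming (_≟_ to _≟ℕ_)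
open import Data.Nat.Properties
  using (≤-refl; ≤-reflexive; ≤-trans; m≤n⇒m≤1+n; +-monoʳ-≤; +-monoˡ-≤; +-identityʳ;
         *-suc; *-identityˡ; ^-identityʳ; module ≤-Reasoning)
open import Data.Product using (Σ; _×_; _,_; proj₁; proj₂; map₁)
open import Data.Sum using (_⊎_; inj₁; inj₂)
open import Data.Vec as Vec using (Vec; []; _∷_; _++_; splitAt)
open import Data.Vec.Properties using (map-∘)
import Data.Vec.Relation.Unary.All as VecAll
import Data.Vec.Relation.Unary.All.Properties as VecAll
open import Function using (_∘_)
open import Relation.Binary.PropositionalEquality
  using (_≡_; _≢_; refl; sym; trans; cong; cong₂; subst; module ≡-Reasoning)
open import Relation.Nullary using (¬_; Dec)
open import Relation.Nullary.Decidable
  using (from-yes; decidable-stable; ¬?; _×-dec_; _→-dec_; map′)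
open import Relation.Unary using (Decidable)

xorSum-map-false : ∀ {A : Set} (f : A → Bool) → (∀ x → f x ≡ false) →
                   ∀ xs → xorSum (map f xs) ≡ false
xorSum-map-false f f≡false []       = refl
xorSum-map-false f f≡false (x ∷ xs) rewrite f≡false x = xorSum-map-false f f≡false xs

xorSum-map-xor : ∀ {A : Set} (f g : A → Bool) xs →
                 xorSum (map (λ x → f x xor g x) xs) ≡ xorSum (map f xs) xor xorSum (map g xs)
xorSum-map-xor f g []       = refl
xorSum-map-xor f g (x ∷ xs) rewrite xorSum-map-xor f g xs = interchange (f x) (g x) _ _

sumHead : ∀ {n} → (Cube (suc n) → Bool) → Cube n → Bool
sumHead f σ = f (nothing ∷ σ) xor (f (just false ∷ σ) xor f (just true ∷ σ))

xorSum-allCubes-suc : ∀ {n} (f : Cube (suc n) → Bool) →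
                      xorSum (map f (allCubes (suc n))) ≡ xorSum (map (sumHead f) (allCubes n))
xorSum-allCubes-suc {n} f = go (allCubes n)
  where
  go : ∀ σs → xorSum (map f (concatMap (λ σ → (nothing ∷ σ) ∷ (just false ∷ σ) ∷ (just true ∷ σ) ∷ []) σs))
            ≡ xorSum (map (sumHead f) σs)
  go []       = refl
  go (σ ∷ σs) rewrite go σs =
    trans (cong (f (nothing ∷ σ) xor_) (sym (xor-assoc (f (just false ∷ σ)) _ _)))
          (sym (xor-assoc (f (nothing ∷ σ)) _ _))

xorSum-allCubes-cubeEq : ∀ {n} (c : Chain n) τ →
                         xorSum (map (λ σ → c σ ∧ cubeEq τ σ) (allCubes n)) ≡ c τ
xorSum-allCubes-cubeEq {zero}  c []      = trans (xor-identityʳ _) (∧-identityʳ (c []))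
xorSum-allCubes-cubeEq {suc n} c (t ∷ τ) =
  trans (xorSum-allCubes-suc (λ σ′ → c σ′ ∧ cubeEq (t ∷ τ) σ′))
        (trans (cong xorSum (map-cong (sumHead-cubeEq t) (allCubes n)))
               (xorSum-allCubes-cubeEq (λ σ → c (t ∷ σ)) τ))
  where
  sumHead-cubeEq : ∀ t σ → sumHead (λ σ′ → c σ′ ∧ cubeEq (t ∷ τ) σ′) σ ≡ c (t ∷ σ) ∧ cubeEq τ σ
  sumHead-cubeEq nothing σ
    rewrite ∧-zeroʳ (c (just false ∷ σ)) | ∧-zeroʳ (c (just true ∷ σ)) = xor-identityʳ _
  sumHead-cubeEq (just false) σ
    rewrite ∧-zeroʳ (c (nothing ∷ σ)) | ∧-zeroʳ (c (just true ∷ σ)) = xor-identityʳ _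
  sumHead-cubeEq (just true) σ
    rewrite ∧-zeroʳ (c (nothing ∷ σ)) | ∧-zeroʳ (c (just false ∷ σ)) = refl

∂-const-false : ∀ {n} (τ : Cube n) → ∂ (λ _ → false) τ ≡ false
∂-const-false {n} τ = xorSum-map-false _ (λ _ → refl) (allCubes n)

∂-nothing∷ : ∀ {n} (c : Chain (suc n)) τ → ∂ c (nothing ∷ τ) ≡ ∂ (λ σ → c (nothing ∷ σ)) τ
∂-nothing∷ {n} c τ =
  trans (xorSum-allCubes-suc (λ σ → c σ ∧ isFacet (nothing ∷ τ) σ))
        (cong xorSum (map-cong sumHead-isFacet (allCubes n)))
  where
  sumHead-isFacet : ∀ σ → sumHead (λ σ′ → c σ′ ∧ isFacet (nothing ∷ τ) σ′) σ ≡ c (nothing ∷ σ) ∧ isFacet τ σ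
  sumHead-isFacet σ
    rewrite ∧-zeroʳ (c (just false ∷ σ)) | ∧-zeroʳ (c (just true ∷ σ)) = xor-identityʳ _

∂-just∷ : ∀ {n} (c : Chain (suc n)) b τ →
          ∂ c (just b ∷ τ) ≡ c (nothing ∷ τ) xor ∂ (λ σ → c (just b ∷ σ)) τ
∂-just∷ {n} c b τ = begin
  ∂ c (just b ∷ τ)
    ≡⟨ xorSum-allCubes-suc (λ σ → c σ ∧ isFacet (just b ∷ τ) σ) ⟩
  xorSum (map (sumHead (λ σ → c σ ∧ isFacet (just b ∷ τ) σ)) (allCubes n))
    ≡⟨ cong xorSum (map-cong (sumHead-isFacet b) (allCubes n)) ⟩
  xorSum (map (λ σ → (c (nothing ∷ σ) ∧ cubeEq τ σ) xor (c (just b ∷ σ) ∧ isFacet τ σ)) (allCubes n))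
    ≡⟨ xorSum-map-xor _ _ (allCubes n) ⟩
  xorSum (map (λ σ → c (nothing ∷ σ) ∧ cubeEq τ σ) (allCubes n)) xor ∂ (λ σ → c (just b ∷ σ)) τ
    ≡⟨ cong (_xor ∂ (λ σ → c (just b ∷ σ)) τ) (xorSum-allCubes-cubeEq (λ σ → c (nothing ∷ σ)) τ) ⟩
  c (nothing ∷ τ) xor ∂ (λ σ → c (just b ∷ σ)) τ
    ∎
  where
  open ≡-Reasoning
  sumHead-isFacet : ∀ b σ → sumHead (λ σ′ → c σ′ ∧ isFacet (just b ∷ τ) σ′) σ
                          ≡ (c (nothing ∷ σ) ∧ cubeEq τ σ) xor (c (just b ∷ σ) ∧ isFacet τ σ)
  sumHead-isFacet false σ rewrite ∧-zeroʳ (c (just true ∷ σ)) =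
    cong ((c (nothing ∷ σ) ∧ cubeEq τ σ) xor_) (xor-identityʳ _)
  sumHead-isFacet true  σ rewrite ∧-zeroʳ (c (just false ∷ σ)) = refl

-- Evaluating ∂ directly sums over all 3ⁿ cubes for each face; ∂ᵣ is cheap to evaluate.
∂ᵣ : ∀ {n} → Chain n → Chain n
∂ᵣ {zero}  c []            = false
∂ᵣ {suc n} c (nothing ∷ τ) = ∂ᵣ (λ σ → c (nothing ∷ σ)) τ
∂ᵣ {suc n} c (just b ∷ τ)  = c (nothing ∷ τ) xor ∂ᵣ (λ σ → c (just b ∷ σ)) τ

∂≗∂ᵣ : ∀ {n} (c : Chain n) τ → ∂ c τ ≡ ∂ᵣ c τ
∂≗∂ᵣ {zero}  c []            = trans (xor-identityʳ _) (∧-zeroʳ (c []))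
∂≗∂ᵣ {suc n} c (nothing ∷ τ) = trans (∂-nothing∷ c τ) (∂≗∂ᵣ _ τ)
∂≗∂ᵣ {suc n} c (just b ∷ τ)  = trans (∂-just∷ c b τ) (cong (c (nothing ∷ τ) xor_) (∂≗∂ᵣ _ τ))

pinHead : ∀ {n} → Bool → Chain n → Chain (suc n)
pinHead b z (t ∷ σ) = meq t (just b) ∧ z σ

pinHead-support : ∀ {n} b (z : Chain n) t σ → pinHead b z (t ∷ σ) ≡ true → t ≡ just b × z σ ≡ true
pinHead-support true  z (just true)  σ zσ = refl , zσ
pinHead-support false z (just false) σ zσ = refl , zσ
pinHead-support true  z (just false) σ ()
pinHead-support false z (just true)  σ ()
pinHead-support b     z nothing      σ ()

∂-scale : ∀ {n} k (c : Chain n) τ → ∂ (λ σ → k ∧ c σ) τ ≡ k ∧ ∂ c τ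
∂-scale true  c τ = refl
∂-scale false c τ = ∂-const-false τ

∂-pinHead : ∀ {n} b (z : Chain n) τ → ∂ (pinHead b z) τ ≡ pinHead b (∂ z) τ
∂-pinHead b z (nothing ∷ τ) = trans (∂-nothing∷ (pinHead b z) τ) (∂-const-false τ)
∂-pinHead b z (just c ∷ τ)  = trans (∂-just∷ (pinHead b z) c τ) (∂-scale (beq c b) z τ)

pinHead-preserves-cycles : ∀ {n} b (z : Chain n) → (∀ τ → ∂ z τ ≡ false) → ∀ τ → ∂ (pinHead b z) τ ≡ false
pinHead-preserves-cycles b z ∂z≡0 (t ∷ τ) =
  trans (∂-pinHead b z (t ∷ τ)) (trans (cong (meq t (just b) ∧_) (∂z≡0 τ)) (∧-zeroʳ _))

copy : ∀ {n} → Bool → Chain n → Chain (suc (suc n))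
copy b = pinHead b ∘ pinHead b

bothCopies : ∀ {n m} → Vec (Chain n) m → Vec (Chain (suc (suc n))) (m + m)
bothCopies zs = Vec.map (copy true) zs ++ Vec.map (copy false) zs

lincomb-++ : ∀ {n m k} (s₁ : Vec Bool m) (s₂ : Vec Bool k) (z₁ : Vec (Chain n) m) z₂ τ →
             lincomb (s₁ ++ s₂) (z₁ ++ z₂) τ ≡ lincomb s₁ z₁ τ xor lincomb s₂ z₂ τ
lincomb-++ []       s₂ []       z₂ τ = refl
lincomb-++ (x ∷ s₁) s₂ (z ∷ z₁) z₂ τ =
  trans (cong ((x ∧ z τ) xor_) (lincomb-++ s₁ s₂ z₁ z₂ τ)) (sym (xor-assoc (x ∧ z τ) _ _))

lincomb-map-pinHead : ∀ {n m} b (s : Vec Bool m) (zs : Vec (Chain n) m) t σ →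
                      lincomb s (Vec.map (pinHead b) zs) (t ∷ σ) ≡ meq t (just b) ∧ lincomb s zs σ
lincomb-map-pinHead b []          []       t σ = sym (∧-zeroʳ _)
lincomb-map-pinHead b (false ∷ s) (z ∷ zs) t σ = lincomb-map-pinHead b s zs t σ
lincomb-map-pinHead b (true ∷ s)  (z ∷ zs) t σ =
  trans (cong ((meq t (just b) ∧ z σ) xor_) (lincomb-map-pinHead b s zs t σ))
        (sym (∧-distribˡ-xor (meq t (just b)) (z σ) _))

lincomb-map-copy : ∀ {n m} b (s : Vec Bool m) (zs : Vec (Chain n) m) t u σ →
                   lincomb s (Vec.map (copy b) zs) (t ∷ u ∷ σ)
                   ≡ meq t (just b) ∧ (meq u (just b) ∧ lincomb s zs σ)
lincomb-map-copy b s zs t u σ = begin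
  lincomb s (Vec.map (copy b) zs) (t ∷ u ∷ σ)
    ≡⟨ cong (λ ws → lincomb s ws (t ∷ u ∷ σ)) (map-∘ (pinHead b) (pinHead b) zs) ⟩
  lincomb s (Vec.map (pinHead b) (Vec.map (pinHead b) zs)) (t ∷ u ∷ σ)
    ≡⟨ lincomb-map-pinHead b s _ t (u ∷ σ) ⟩
  meq t (just b) ∧ lincomb s (Vec.map (pinHead b) zs) (u ∷ σ)
    ≡⟨ cong (meq t (just b) ∧_) (lincomb-map-pinHead b s zs u σ) ⟩
  meq t (just b) ∧ (meq u (just b) ∧ lincomb s zs σ)
    ∎
  where open ≡-Reasoning

lincomb-bothCopies : ∀ {n m} b (s₁ s₂ : Vec Bool m) (zs : Vec (Chain n) m) τ →
                     lincomb (s₁ ++ s₂) (bothCopies zs) (just b ∷ just b ∷ τ)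
                     ≡ lincomb (if b then s₁ else s₂) zs τ
lincomb-bothCopies b s₁ s₂ zs τ =
  trans (lincomb-++ s₁ s₂ (Vec.map (copy true) zs) (Vec.map (copy false) zs) _)
        (trans (cong₂ _xor_ (lincomb-map-copy true s₁ zs _ _ τ) (lincomb-map-copy false s₂ zs _ _ τ))
               (select b))
  where
  select : ∀ b → (meq (just b) (just true) ∧ (meq (just b) (just true) ∧ lincomb s₁ zs τ))
                 xor (meq (just b) (just false) ∧ (meq (just b) (just false) ∧ lincomb s₂ zs τ))
               ≡ lincomb (if b then s₁ else s₂) zs τ
  select true  = xor-identityʳ _
  select false = refl

Nonzero-++ : ∀ {m k} (s₁ : Vec Bool m) (s₂ : Vec Bool k) → Nonzero (s₁ ++ s₂) → Nonzero s₁ ⊎ Nonzero s₂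
Nonzero-++ []           s₂ s≢0 = inj₂ s≢0
Nonzero-++ (true ∷ s₁)  s₂ s≢0 = inj₁ refl
Nonzero-++ (false ∷ s₁) s₂ s≢0 = Nonzero-++ s₁ s₂ s≢0

weakenClause : ∀ {n} → Clause3 n → Clause3 (suc n)
weakenClause = Vec.map (map₁ fsuc)

weaken : ∀ {n} → CNF3 n → CNF3 (suc n)
weaken = map weakenClause

satisfies-weaken : ∀ {n} a (v : Assignment n) F → satisfies (a ∷ v) (weaken F) ≡ satisfies v F
satisfies-weaken a v []                        = refl
satisfies-weaken a v ((l₁ ∷ l₂ ∷ l₃ ∷ []) ∷ F) =
  cong (clauseSat v (l₁ ∷ l₂ ∷ l₃ ∷ []) ∧_) (satisfies-weaken a v F)

-- The first two clauses say x₀ ⇒ x₁ and x₁ ⇒ x₀.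
double : ∀ {n} → CNF3 n → CNF3 (suc (suc n))
double F = ((fzero , false) ∷ (fsuc fzero , true)  ∷ (fsuc fzero , true)  ∷ [])
         ∷ ((fzero , true)  ∷ (fsuc fzero , false) ∷ (fsuc fzero , false) ∷ [])
         ∷ weaken (weaken F)

satisfies-double : ∀ {n} b (v : Assignment n) F → satisfies (b ∷ b ∷ v) (double F) ≡ satisfies v F
satisfies-double b v F =
  trans (equality-clauses-hold b) (trans (satisfies-weaken b (b ∷ v) (weaken F)) (satisfies-weaken b v F))
  where
  equality-clauses-hold : ∀ b → satisfies (b ∷ b ∷ v) (double F) ≡ satisfies (b ∷ b ∷ v) (weaken (weaken F))
  equality-clauses-hold true  = refl
  equality-clauses-hold false = refl

someVertex : ∀ {n} → Cube n → Assignment n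
someVertex []            = []
someVertex (nothing ∷ σ) = false ∷ someVertex σ
someVertex (just b ∷ σ)  = b ∷ someVertex σ

someVertex-isVertex : ∀ {n} (σ : Cube n) → vertexOf (someVertex σ) σ ≡ true
someVertex-isVertex []               = refl
someVertex-isVertex (nothing ∷ σ)    = someVertex-isVertex σ
someVertex-isVertex (just false ∷ σ) = someVertex-isVertex σ
someVertex-isVertex (just true ∷ σ)  = someVertex-isVertex σ

InS-double⁺ : ∀ {n} {F : CNF3 n} {σ} b → InS F σ → InS (double F) (just b ∷ just b ∷ σ)
InS-double⁺ {F = F} true  σ∈ (true ∷ true ∷ v)   v∈ = trans (satisfies-double true v F) (σ∈ v v∈)
InS-double⁺ {F = F} false σ∈ (false ∷ false ∷ v) v∈ = trans (satisfies-double false v F) (σ∈ v v∈)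
InS-double⁺ true  σ∈ (true ∷ false ∷ v)  ()
InS-double⁺ true  σ∈ (false ∷ c ∷ v)     ()
InS-double⁺ false σ∈ (false ∷ true ∷ v)  ()
InS-double⁺ false σ∈ (true ∷ c ∷ v)      ()

InS-double⁻ : ∀ {n} {F : CNF3 n} {σ} b → InS (double F) (just b ∷ just b ∷ σ) → InS F σ
InS-double⁻ {F = F} b σ∈ v v∈ = trans (sym (satisfies-double b v F)) (σ∈ (b ∷ b ∷ v) (vertexOf-just∷just∷ b))
  where
  vertexOf-just∷just∷ : ∀ b → vertexOf (b ∷ b ∷ v) (just b ∷ just b ∷ _) ≡ true
  vertexOf-just∷just∷ true  = v∈
  vertexOf-just∷just∷ false = v∈

-- Each of these cubes has a vertex with x₀ ≠ x₁.
¬InS-double-nothing₀ : ∀ {n} {F : CNF3 n} b σ → ¬ InS (double F) (nothing ∷ just b ∷ σ)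
¬InS-double-nothing₀ true  σ σ∈ with σ∈ (false ∷ true ∷ someVertex σ) (someVertex-isVertex σ)
... | ()
¬InS-double-nothing₀ false σ σ∈ with σ∈ (true ∷ false ∷ someVertex σ) (someVertex-isVertex σ)
... | ()

¬InS-double-nothing₁ : ∀ {n} {F : CNF3 n} b σ → ¬ InS (double F) (just b ∷ nothing ∷ σ)
¬InS-double-nothing₁ true  σ σ∈ with σ∈ (true ∷ false ∷ someVertex σ) (someVertex-isVertex σ)
... | ()
¬InS-double-nothing₁ false σ σ∈ with σ∈ (false ∷ true ∷ someVertex σ) (someVertex-isVertex σ)
... | ()

IsChain-vanishes : ∀ {n} {F : CNF3 n} {k d} → IsChain F k d → ∀ σ → ¬ ((dim σ ≡ k) × InS F σ) → d σ ≡ false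
IsChain-vanishes {d = d} d-chain σ σ∉ with d σ in dσ
... | true  = ⊥-elim (σ∉ (d-chain σ dσ))
... | false = refl

IsChain-copy : ∀ {n} {F : CNF3 n} {k z} b → IsChain F k z → IsChain (double F) k (copy b z)
IsChain-copy {F = F} {z = z} b z-chain (t₀ ∷ t₁ ∷ σ) zσ
  with pinHead-support b (pinHead b z) t₀ (t₁ ∷ σ) zσ
... | refl , zσ₁ with pinHead-support b z t₁ σ zσ₁
... | refl , zσ₂ = proj₁ (z-chain σ zσ₂) , InS-double⁺ {F = F} b (proj₂ (z-chain σ zσ₂))

IsCycle-copy : ∀ {n} {F : CNF3 n} {k z} b → IsCycle F k z → IsCycle (double F) k (copy b z)
IsCycle-copy {F = F} {z = z} b (z-chain , ∂z≡0) =
  IsChain-copy {F = F} b z-chain ,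
  pinHead-preserves-cycles b (pinHead b z) (pinHead-preserves-cycles b z ∂z≡0)

restrict : ∀ {n} → Bool → Chain (suc (suc n)) → Chain n
restrict b d σ = d (just b ∷ just b ∷ σ)

IsChain-restrict : ∀ {n} {F : CNF3 n} {k d} b → IsChain (double F) k d → IsChain F k (restrict b d)
IsChain-restrict {F = F} b d-chain σ dσ = proj₁ (d-chain _ dσ) , InS-double⁻ {F = F} b (proj₂ (d-chain _ dσ))

∂-restrict : ∀ {n} {F : CNF3 n} {k d} → IsChain (double F) k d →
             ∀ b τ → ∂ d (just b ∷ just b ∷ τ) ≡ ∂ (restrict b d) τ
∂-restrict {F = F} {d = d} d-chain b τ = begin
  ∂ d (just b ∷ just b ∷ τ)
    ≡⟨ ∂-just∷ d b (just b ∷ τ) ⟩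
  d (nothing ∷ just b ∷ τ) xor ∂ (λ σ → d (just b ∷ σ)) (just b ∷ τ)
    ≡⟨ cong₂ _xor_ (outside (¬InS-double-nothing₀ {F = F} b τ)) (∂-just∷ (λ σ → d (just b ∷ σ)) b τ) ⟩
  d (just b ∷ nothing ∷ τ) xor ∂ (restrict b d) τ
    ≡⟨ cong (_xor ∂ (restrict b d) τ) (outside (¬InS-double-nothing₁ {F = F} b τ)) ⟩
  ∂ (restrict b d) τ
    ∎
  where
  open ≡-Reasoning
  outside : ∀ {σ} → ¬ InS (double F) σ → d σ ≡ false
  outside σ∉ = IsChain-vanishes {F = double F} d-chain _ (σ∉ ∘ proj₂)

bettiAtLeast-double : ∀ {n} {F : CNF3 n} {k m} → BettiAtLeast F k m → BettiAtLeast (double F) k (m + m)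
bettiAtLeast-double {F = F} {k} {m} (zs , zs-cycles , zs-independent) =
  bothCopies zs , VecAll.lookup⁺ (VecAll.++⁺ (copies-cycles true) (copies-cycles false)) , independent
  where
  copies-cycles : ∀ b → VecAll.All (IsCycle (double F) k) (Vec.map (copy b) zs)
  copies-cycles b = VecAll.map⁺ (VecAll.map (IsCycle-copy {F = F} b) (VecAll.lookup⁻ zs-cycles))

  restrict-boundary : ∀ b (s₁ s₂ : Vec Bool m) → IsBoundary (double F) k (lincomb (s₁ ++ s₂) (bothCopies zs)) →
                      IsBoundary F k (lincomb (if b then s₁ else s₂) zs)
  restrict-boundary b s₁ s₂ (d , d-chain , ∂d≡) =
    restrict b d , IsChain-restrict {F = F} b d-chain ,
    λ τ → trans (sym (∂-restrict {F = F} d-chain b τ)) (trans (∂d≡ _) (lincomb-bothCopies b s₁ s₂ zs τ))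

  independent : (s : Vec Bool (m + m)) → Nonzero s → ¬ IsBoundary (double F) k (lincomb s (bothCopies zs))
  independent s s≢0 with splitAt m s
  ... | s₁ , s₂ , refl with Nonzero-++ s₁ s₂ s≢0
  ... | inj₁ s₁≢0 = zs-independent s₁ s₁≢0 ∘ restrict-boundary true  s₁ s₂
  ... | inj₂ s₂≢0 = zs-independent s₂ s₂≢0 ∘ restrict-boundary false s₁ s₂

boundaries-vanish : ∀ {n} {F : CNF3 n} {k c} → (∀ σ → InS F σ → dim σ ≢ suc k) →
                    IsBoundary F k c → ∀ τ → c τ ≡ false
boundaries-vanish {n} {F} noFaces (d , d-chain , ∂d≡c) τ =
  trans (sym (∂d≡c τ)) (xorSum-map-false _ summand-vanishes (allCubes n))
  where
  summand-vanishes : ∀ σ → d σ ∧ isFacet τ σ ≡ false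
  summand-vanishes σ =
    cong (_∧ isFacet τ σ) (IsChain-vanishes {F = F} d-chain σ λ (dσ , σ∈) → noFaces σ σ∈ dσ)

bettiAtLeast-one : ∀ {n} {F : CNF3 n} {k z} τ → (∀ σ → InS F σ → dim σ ≢ suc k) →
                   IsCycle F k z → z τ ≡ true → BettiAtLeast F k 1
bettiAtLeast-one {F = F} {k} {z} τ noFaces z-cycle zτ = z ∷ [] , (λ { fzero → z-cycle }) , independent
  where
  independent : (s : Vec Bool 1) → Nonzero s → ¬ IsBoundary F k (lincomb s (z ∷ []))
  independent (true ∷ []) _ bd
    with trans (sym zτ) (trans (sym (xor-identityʳ (z τ))) (boundaries-vanish {F = F} noFaces bd τ))
  ... | ()

∈-allCubes : ∀ {n} (σ : Cube n) → σ ∈ allCubes n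
∈-allCubes []      = here refl
∈-allCubes (t ∷ σ) = ∈-concatMap⁺ extensions (Any.map (λ { refl → head-∈ t }) (∈-allCubes σ))
  where
  extensions : Cube _ → List (Cube _)
  extensions σ = (nothing ∷ σ) ∷ (just false ∷ σ) ∷ (just true ∷ σ) ∷ []
  head-∈ : ∀ t → (t ∷ σ) ∈ extensions σ
  head-∈ nothing      = here refl
  head-∈ (just false) = there (here refl)
  head-∈ (just true)  = there (there (here refl))

All-allCubes⇒∀ : ∀ {n} {P : Cube n → Set} → All.All P (allCubes n) → ∀ σ → P σ
All-allCubes⇒∀ all-P σ = All.lookup all-P (∈-allCubes σ)

-- Assignments are Boolean vectors, i.e. subsets of Fin n, so the library search over subsets applies.
∀-Assignment? : ∀ {n} {P : Assignment n → Set} → Decidable P → Dec (∀ v → P v)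
∀-Assignment? P? =
  map′ (λ ¬∃ v → decidable-stable (P? v) (λ ¬Pv → ¬∃ (v , ¬Pv)))
       (λ ∀P (v , ¬Pv) → ¬Pv (∀P v))
       (¬? (anySubset? (¬? ∘ P?)))

InS? : ∀ {n} (F : CNF3 n) → Decidable (InS F)
InS? F σ = ∀-Assignment? (λ v → (vertexOf v σ ≟ᵇ true) →-dec (satisfies v F ≟ᵇ true))

notAllEqual : ∀ {n} → Fin n → Fin n → Fin n → CNF3 n
notAllEqual i j k = ((i , true)  ∷ (j , true)  ∷ (k , true)  ∷ [])
                  ∷ ((i , false) ∷ (j , false) ∷ (k , false) ∷ [])
                  ∷ []

torusFormula : CNF3 6
torusFormula = notAllEqual (# 0) (# 1) (# 2) ++ᴸ notAllEqual (# 3) (# 4) (# 5)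

-- The six edges of {0,1}³ avoiding 000 and 111: one free coordinate, the fixed two differ.
hexagonEdge : Maybe Bool → Maybe Bool → Maybe Bool → Bool
hexagonEdge nothing  (just p) (just q) = not (beq p q)
hexagonEdge (just p) nothing  (just q) = not (beq p q)
hexagonEdge (just p) (just q) nothing  = not (beq p q)
hexagonEdge _        _        _        = false

torus : Chain 6
torus (a ∷ b ∷ c ∷ d ∷ e ∷ f ∷ []) = hexagonEdge a b c ∧ hexagonEdge d e f

torus-isCycle : IsCycle torusFormula 2 torus
torus-isCycle =
  All-allCubes⇒∀ (from-yes (all? chain? (allCubes 6))) ,
  (λ τ → trans (∂≗∂ᵣ torus τ) (All-allCubes⇒∀ (from-yes (all? (λ τ → ∂ᵣ torus τ ≟ᵇ false) (allCubes 6))) τ))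
  where
  chain? : (σ : Cube 6) → Dec (torus σ ≡ true → (dim σ ≡ 2) × InS torusFormula σ)
  chain? σ = (torus σ ≟ᵇ true) →-dec ((dim σ ≟ℕ 2) ×-dec InS? torusFormula σ)

torusFormula-no-3-faces : ∀ σ → InS torusFormula σ → dim σ ≢ 3
torusFormula-no-3-faces σ σ∈ dσ≡3 =
  All-allCubes⇒∀ (from-yes (all? (λ σ → (dim σ ≟ℕ 3) →-dec ¬? (InS? torusFormula σ)) (allCubes 6))) σ dσ≡3 σ∈

torus-betti : BettiAtLeast torusFormula 2 1
torus-betti =
  bettiAtLeast-one {F = torusFormula} (nothing ∷ just false ∷ just true ∷ nothing ∷ just false ∷ just true ∷ [])
                   torusFormula-no-3-faces torus-isCycle refl

vars : ℕ → ℕ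
vars zero    = 6
vars (suc N) = 2 + vars N

formula : (N : ℕ) → CNF3 (vars N)
formula zero    = torusFormula
formula (suc N) = double (formula N)

formula-betti : ∀ N → BettiAtLeast (formula N) 2 (2 ^ N)
formula-betti zero    = torus-betti
formula-betti (suc N) =
  subst (BettiAtLeast (formula (suc N)) 2) (cong (2 ^ N +_) (sym (+-identityʳ (2 ^ N))))
        (bettiAtLeast-double {F = formula N} (formula-betti N))

N≤vars : ∀ N → N ≤ vars N
N≤vars zero    = z≤n
N≤vars (suc N) = s≤s (m≤n⇒m≤1+n (N≤vars N))

vars≤8* : ∀ N → vars (suc N) ≤ 8 * suc N
vars≤8* zero    = ≤-refl
vars≤8* (suc N) = begin
  2 + vars (suc N)  ≤⟨ +-monoʳ-≤ 2 (vars≤8* N) ⟩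
  2 + 8 * suc N     ≤⟨ +-monoˡ-≤ (8 * suc N) {2} {8} (s≤s (s≤s z≤n)) ⟩
  8 + 8 * suc N     ≡⟨ *-suc 8 (suc N) ⟨
  8 * suc (suc N)   ∎
  where open ≤-Reasoning

mainTheorem5 : Σ (ℕ → Σ ℕ CNF3) λ fam →
    (Σ ℕ λ a → Σ ℕ λ b → Σ ℕ λ N₀ →
    (1 ≤ a) × (1 ≤ b) ×
    ((N : ℕ) → N₀ ≤ N →
    (N ≤ a * Σ.proj₁ (fam N)) × (Σ.proj₁ (fam N) ≤ b * N))) ×
    (Σ ℕ λ p → Σ ℕ λ q → Σ ℕ λ N₁ →
    (1 ≤ p) × (1 ≤ q) ×
    ((N : ℕ) → N₁ ≤ N →
    Σ ℕ λ β → BettiAtLeast (Σ.proj₂ (fam N)) 2 β × (2 ^ (p * N) ≤ β ^ q)))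
mainTheorem5 =
  (λ N → vars N , formula N) ,
  (1 , 8 , 1 , s≤s z≤n , s≤s z≤n , vars-linear) ,
  (1 , 1 , 0 , s≤s z≤n , s≤s z≤n , λ N _ → 2 ^ N , formula-betti N , 2^N≤[2^N]^1 N)
  where
  vars-linear : ∀ N → 1 ≤ N → (N ≤ 1 * vars N) × (vars N ≤ 8 * N)
  vars-linear (suc N) _ = ≤-trans (N≤vars (suc N)) (≤-reflexive (sym (*-identityˡ _))) , vars≤8* N

  2^N≤[2^N]^1 : ∀ N → 2 ^ (1 * N) ≤ (2 ^ N) ^ 1
  2^N≤[2^N]^1 N = ≤-reflexive (trans (cong (2 ^_) (*-identityˡ N)) (sym (^-identityʳ (2 ^ N))))
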